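{- For every integer $n>1$, the simple context processor $SCP_n$ is a sound and complete CDP processor; that is, for every CDP problem $Prob$: if every problem in $SCP_n(Prob)$ is finite then $Prob$ is finite (soundness), and if some problem in $SCP_n(Prob)$ is infinite then $Prob$ is infinite (completeness).
   Context: Positions are finite sequences of positive integers; $\epsilon$ is the root; $q\le q'$ means $q$ is a prefix of $q'$, $q>q'$ strictly below, $q\parallel q'$ parallel (incomparable). A context $c[\Box]_p$ is a term with a single hole $\Box$ at position $p$; $c[u]_p$ fills the hole. A rule $l\to r$ overlaps a term $t$ at a non-variable position $p$ of $t$ if $l$ (renamed apart) and $t|_p$ unify. Forbidden patterns: triples $\langle t,p,\lambda\rangle$, $t$ a term, $p\in Pos(t)$, $\lambda\in\{h,b,a\}$. For a term $s$, $P_{t,p}(s)=\{o.p\mid s|_o=t\sigma$ for some $\sigma,o\}$; $P_\pi(s)$ is $\{o\mid\exists q\in P_{t,p}(s):o<q\}$ if $\lambda=a$, $\{o\mid \exists q\in P_{t,p}(s):o>q\}$ if $\lambda=b$, and $P_{t,p}(s)$ if $\lambda=h$. Forbidden positions of $s$ w.r.t. a set $\Pi$: $\bigcup_{\pi\in\Pi}P_\pi(s)$; the rest are allowed. A position is forbidden by a pattern $\pi$ if it lies in $P_\pi(s)$. $s\rightarrow_{\mathcal{R},\Pi}t$ is an $\mathcal{R}$-step at a position allowed in $s$. $\overset{\not\le p}{\to}$ denotes a step at a position strictly below or parallel to $p$. A term $s$ is $\Pi$-terminating in context $C[\Box]_p$ if $C[s]_p$ admits no infinite $\Pi$-reduction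 in which all contracted redexes are at, below or parallel to $p$ and infinitely many are at or below $p$. Marked symbols and $T$: for each function symbol $f$ there is a fresh marked symbol $f^{\#}$; $T$ is a fresh unary symbol. For a term $s$, $erase(s)$ replaces each $f^{\#}$ by $f$ and each subterm $T(s')$ by $s'$. A contextual rule $u\to v\,[c]$ ($c$ a context) used as rewrite rule means $u\to c[v]$; for a set $\mathcal{P}$ of such rules, $\rightarrow_\mathcal{P}$ is the induced rewrite relation. A CDP problem is a quadruple $(\mathcal{P},\mathcal{R},\Pi,T)$ with $\mathcal{P}$ a set of contextual rules (CDPs), $\mathcal{R}=(\mathcal{F},R)$ a TRS, $\Pi$ forbidden patterns over $\mathcal{F}$, $T\notin\mathcal{F}$ occurring only at the root of left- and right-hand sides of rules in $\mathcal{P}$. CDP chains: a sequence $s_1\to t_1[c_1[\Box]_{p_1}], s_2\to t_2[c_2[\Box]_{p_2}],\dots$ of elements of $\mathcal{P}$ (renamed variable-disjoint) is a CDP chain if there is a substitution $\sigma$ such that, with $p_0'=\epsilon$, $c_0''=\Box$, for all $i\ge1$: $c_{i-1}''[s_i\sigma]_{p_{i-1}'}\rightarrow_{\mathcal{P}} c_{i-1}''[c_i[t_i\sigma]_{p_i}]_{p_{i-1}'}=c_i'[t_i\sigma]_{p_i'}$ with $p_i'=p_{i-1}'.p_i$, $c_i'=c_{i-1}''[c_i]$, followed by $c_i'[t_i\sigma]_{p_i'}\overset{\not\le p_i'}{\rightarrow}{}^*_{\mathcal{R}} c_i''[s_{i+1}\sigma]_{p_i'}$, which is empty whenever $root(t_i)=T$;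 and every single step $s\overset{q}{\to}t$ (by $\mathcal{P}$ or $\mathcal{R}$) in the sequence has $q$ allowed in $erase(s)$ w.r.t. $\Pi$. The chain is minimal if for every $i$ every subterm of $c_i'[t_i\sigma]_{p_i'}$ at a position $q>p_i'$ is $\Pi$-terminating in its context w.r.t. $\mathcal{R}$. A CDP problem is finite if it admits no infinite minimal CDP chain, and infinite otherwise. A CDP processor is a function mapping CDP problems to sets of CDP problems. $\Pi_{orth}$: the set of patterns $\langle t,p,\lambda\rangle\in\Pi$ with $\lambda\in\{h,b\}$, $t$ linear, and $t$ not overlapped by any rule of $\mathcal{R}$ at any position parallel to or below $p$. Simple context processor: let $Prob=(\{s\to t[c[\Box]_p]\}\uplus\mathcal{P},\mathcal{R},\Pi,T)$ and $n$ a bound. $SCP_n(Prob)=\{(\mathcal{P},\mathcal{R},\Pi,T)\}$ if for every sequence of CDPs (of $Prob$) $s\to t[c[\Box]_p], s_2\to t_2[c_2[\Box]_{p_2}],\dots,s_n\to t_n[c_n[\Box]_{p_n}]$ the position $p.p_2.\cdots.p_n$ is forbidden in the term $c[c_2[\dots c_n[erase(t_n)]_{p_n}\dots]_{p_2}]_p$ by a forbidden pattern of $\Pi_{orth}$; and $SCP_n(Prob)=\{Prob\}$ otherwise. -}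

module Defs where

open import Data.Nat using (ℕ; zero; suc; _∸_; _<_; _≤_)
open import Data.Vec using (Vec; []; _∷_)
open import Data.List using (List; []; _∷_; _++_; length)
open import Data.List.Relation.Unary.All using (All)
open import Data.Maybe using (Maybe; just; nothing)
open import Data.Product using (Σ; ∃; _×_; _,_)
open import Data.Sum using (_⊎_)
open import Relation.Nullary using (¬_)
open import Relation.Binary.PropositionalEquality using (_≡_)

record Signature : Set₁ where
  field
    Sym   : Set
    arity : Sym → ℕ
open Signature public

data Term (F : Signature) : Set where
  var : ℕ → Term F
  fun : (f : Sym F) → Vec (Term F) (arity F f) → Term F

-- positions: lists of positive integers (argument indices are 1-based)
Pos : Set
Pos = List ℕ

_≤ₚ_ : Pos → Pos → Set
q ≤ₚ q' = ∃ λ r → q ++ r ≡ q'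

_<ₚ_ : Pos → Pos → Set
q <ₚ q' = ∃ λ r → ¬ (r ≡ []) × (q ++ r ≡ q')

_∥_ : Pos → Pos → Set
q ∥ q' = ¬ (q ≤ₚ q') × ¬ (q' ≤ₚ q)

Subst : Signature → Set
Subst F = ℕ → Term F

module _ {F : Signature} where

  mutual
    _∣_ : Term F → Pos → Maybe (Term F)
    t ∣ [] = just t
    var x ∣ (i ∷ p) = nothing
    fun f ts ∣ (i ∷ p) = argAt ts i p

    argAt : ∀ {n} → Vec (Term F) n → ℕ → Pos → Maybe (Term F)
    argAt [] i p = nothing
    argAt (t ∷ ts) zero p = nothing
    argAt (t ∷ ts) (suc zero) p = t ∣ p
    argAt (t ∷ ts) (suc (suc i)) p = argAt ts (suc i) p

  -- replacement s[u]_p (identity if p is not a position of s)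
  mutual
    replace : Term F → Pos → Term F → Term F
    replace t [] u = u
    replace (var x) (i ∷ p) u = var x
    replace (fun f ts) (i ∷ p) u = fun f (replaceArg ts i p u)

    replaceArg : ∀ {n} → Vec (Term F) n → ℕ → Pos → Term F → Vec (Term F) n
    replaceArg [] i p u = []
    replaceArg (t ∷ ts) zero p u = t ∷ ts
    replaceArg (t ∷ ts) (suc zero) p u = replace t p u ∷ ts
    replaceArg (t ∷ ts) (suc (suc i)) p u = t ∷ replaceArg ts (suc i) p u

  mutual
    _·_ : Term F → Subst F → Term F
    var x · σ = σ x
    fun f ts · σ = fun f (mapSub ts σ)

    mapSub : ∀ {n} → Vec (Term F) n → Subst F → Vec (Term F) n
    mapSub [] σ = []
    mapSub (t ∷ ts) σ = (t · σ) ∷ mapSub ts σ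

  _∈Pos_ : Pos → Term F → Set
  p ∈Pos t = ∃ λ u → t ∣ p ≡ just u

  NonVarPos : Term F → Pos → Set
  NonVarPos t p = ∃ λ f → ∃ λ ts → t ∣ p ≡ just (fun f ts)

  Linear : Term F → Set
  Linear t = ∀ p q x → t ∣ p ≡ just (var x) → t ∣ q ≡ just (var x) → p ≡ q

record Rule (F : Signature) : Set where
  constructor _⟶_
  field
    lhs : Term F
    rhs : Term F
open Rule public

IsTRS : {F : Signature} → (Rule F → Set) → Set
IsTRS R = ∀ ρ → R ρ →
  (∀ x → ¬ (lhs ρ ≡ var x)) ×
  (∀ p x → rhs ρ ∣ p ≡ just (var x) → ∃ λ q → lhs ρ ∣ q ≡ just (var x))

data Label : Set where
  h b a : Label

record Pattern (F : Signature) : Set where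
  constructor ⟨_,_,_⟩
  field
    pterm  : Term F
    ppos   : Pos
    plabel : Label
open Pattern public

WFPatterns : {F : Signature} → (Pattern F → Set) → Set
WFPatterns Π = ∀ π → Π π → ppos π ∈Pos pterm π

-- Extended signature: marked symbols f#, the fresh unary symbol T, and
-- a hole constant □ used to represent contexts.

data XSym (F : Signature) : Set where
  base : Sym F → XSym F
  mark : Sym F → XSym F
  Tsym : XSym F
  hole : XSym F

xarity : {F : Signature} → XSym F → ℕ
xarity {F} (base f) = arity F f
xarity {F} (mark f) = arity F f
xarity Tsym = 1
xarity hole = 0

XSig : Signature → Signature
XSig F = record { Sym = XSym F ; arity = xarity }

XTerm : Signature → Set
XTerm F = Term (XSig F)

module _ {F : Signature} where

  mutual
    emb : Term F → XTerm F
    emb (var x) = var x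
    emb (fun f ts) = fun (base f) (embV ts)

    embV : ∀ {n} → Vec (Term F) n → Vec (XTerm F) n
    embV [] = []
    embV (t ∷ ts) = emb t ∷ embV ts

  mutual
    erase : XTerm F → XTerm F
    erase (var x) = var x
    erase (fun (base f) ts) = fun (base f) (eraseV ts)
    erase (fun (mark f) ts) = fun (base f) (eraseV ts)
    erase (fun Tsym (t ∷ [])) = erase t
    erase (fun hole []) = fun hole []

    eraseV : ∀ {n} → Vec (XTerm F) n → Vec (XTerm F) n
    eraseV [] = []
    eraseV (t ∷ ts) = erase t ∷ eraseV ts

  □ : XTerm F
  □ = fun hole []

  RootT : XTerm F → Set
  RootT t = ∃ λ u → t ≡ fun Tsym (u ∷ [])

  TOnlyAtRoot : XTerm F → Set
  TOnlyAtRoot t = ∀ q u → t ∣ q ≡ just (fun Tsym (u ∷ [])) → q ≡ []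

  NoT : XTerm F → Set
  NoT t = ∀ q u → ¬ (t ∣ q ≡ just (fun Tsym (u ∷ [])))

  NoHole : XTerm F → Set
  NoHole t = ∀ q → ¬ (t ∣ q ≡ just □)

  PatPos : Term F → Pos → XTerm F → Pos → Set
  PatPos t p s q = ∃ λ o → (q ≡ o ++ p) × ∃ λ σ → s ∣ o ≡ just (emb t · σ)

  PPi : Pattern F → XTerm F → Pos → Set
  PPi ⟨ t , p , a ⟩ s o = ∃ λ q → PatPos t p s q × (o <ₚ q)
  PPi ⟨ t , p , b ⟩ s o = ∃ λ q → PatPos t p s q × (q <ₚ o)
  PPi ⟨ t , p , h ⟩ s o = PatPos t p s o

  ForbiddenBy : (Pattern F → Set) → XTerm F → Pos → Set
  ForbiddenBy Π s o = (o ∈Pos s) × ∃ λ π → Π π × PPi π s o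

  Allowed : (Pattern F → Set) → XTerm F → Pos → Set
  Allowed Π s o = (o ∈Pos s) × ¬ ForbiddenBy Π s o

  RStep : (Rule F → Set) → XTerm F → Pos → XTerm F → Set
  RStep R s q t = ∃ λ ρ → R ρ × ∃ λ σ →
    (s ∣ q ≡ just (emb (lhs ρ) · σ)) × (t ≡ replace s q (emb (rhs ρ) · σ))

  PiStep : (Rule F → Set) → (Pattern F → Set) → XTerm F → Pos → XTerm F → Set
  PiStep R Π s q t = RStep R s q t × Allowed Π s q

  -- "s is Π-terminating in context C[□]_p", where w = C[s]_p
  TermInContext : (Rule F → Set) → (Pattern F → Set) → XTerm F → Pos → Set
  TermInContext R Π w p = ¬ (Σ (ℕ → XTerm F) λ u → Σ (ℕ → Pos) λ qs →
      (u 0 ≡ w)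
    × (∀ j → PiStep R Π (u j) (qs j) (u (suc j)))
    × (∀ j → ¬ (qs j <ₚ p))
    × (∀ j → ∃ λ j' → (j ≤ j') × (p ≤ₚ qs j')))

  data ChainSteps (R : Rule F → Set) (Π : Pattern F → Set) (p : Pos)
       : XTerm F → XTerm F → Set where
    done : ∀ {s} → ChainSteps R Π p s s
    step : ∀ {s q t u} → RStep R s q t → ¬ (q ≤ₚ p) → Allowed Π (erase s) q →
           ChainSteps R Π p t u → ChainSteps R Π p s u

record CDP (F : Signature) : Set where
  field
    cl  : XTerm F
    cr  : XTerm F
    cc  : XTerm F
    cp  : Pos
open CDP public

module _ {F : Signature} where

  fill : XTerm F → Pos → XTerm F → XTerm F
  fill c p u = replace c p u

  -- the CDP as a rewrite rule  s → c[t]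
  cdpRhs : CDP F → XTerm F
  cdpRhs ρ = fill (cc ρ) (cp ρ) (cr ρ)

  WFCDP : CDP F → Set
  WFCDP ρ = (cc ρ ∣ cp ρ ≡ just □)
          × (∀ q → cc ρ ∣ q ≡ just □ → q ≡ cp ρ)
          × NoHole (cl ρ) × NoHole (cr ρ)
          × TOnlyAtRoot (cl ρ) × TOnlyAtRoot (cr ρ) × NoT (cc ρ)

-- CDP problems (P, R, Π, T); T is the fixed symbol Tsym
record CDPProblem (F : Signature) : Set₁ where
  constructor problem
  field
    PP  : CDP F → Set
    RR  : Rule F → Set
    ΠΠ  : Pattern F → Set
open CDPProblem public

WFProblem : {F : Signature} → CDPProblem F → Set
WFProblem Prob = (∀ ρ → PP Prob ρ → WFCDP ρ) × IsTRS (RR Prob) × WFPatterns (ΠΠ Prob)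

module _ {F : Signature} (Prob : CDPProblem F) where

  -- p'_k : p'_0 = ε, p'_{k+1} = p'_k . p_{k}   (the k-th CDP of the chain is ρ k, k = 0,1,…)
  accPos : (ℕ → CDP F) → ℕ → Pos
  accPos ρ zero = []
  accPos ρ (suc k) = accPos ρ k ++ cp (ρ k)

  -- b_k = c''_{k-1}[ (c_k[t_k])σ_k ]_{p'_{k-1}} , the result of the k-th P-step from a_k
  afterP : (ℕ → CDP F) → (ℕ → Subst (XSig F)) → (ℕ → XTerm F) → ℕ → XTerm F
  afterP ρ σ as k = replace (as k) (accPos ρ k) (cdpRhs (ρ k) · σ k)

  -- infinite CDP chain: a_k = c''_{k-1}[s_k σ_k]_{p'_{k-1}}
  -- (one substitution per chain element = variable-disjoint renaming + single σ)
  record Chain (ρ : ℕ → CDP F) : Set where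
    field
      inP      : ∀ k → PP Prob (ρ k)
      σ        : ℕ → Subst (XSig F)
      as       : ℕ → XTerm F
      lhsAt    : ∀ k → as k ∣ accPos ρ k ≡ just (cl (ρ k) · σ k)
      Pallowed : ∀ k → Allowed (ΠΠ Prob) (erase (as k)) (accPos ρ k)
      Rsteps   : ∀ k → ChainSteps (RR Prob) (ΠΠ Prob) (accPos ρ (suc k))
                                  (afterP ρ σ as k) (as (suc k))
      Tempty   : ∀ k → RootT (cr (ρ k)) → afterP ρ σ as k ≡ as (suc k)

  Minimal : {ρ : ℕ → CDP F} → Chain ρ → Set
  Minimal {ρ} ch = ∀ k q u → accPos ρ (suc k) <ₚ q →
      afterP ρ (Chain.σ ch) (Chain.as ch) k ∣ q ≡ just u →
      TermInContext (RR Prob) (ΠΠ Prob) (afterP ρ (Chain.σ ch) (Chain.as ch) k) q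

  Finite : Set
  Finite = ¬ (Σ (ℕ → CDP F) λ ρ → Σ (Chain ρ) λ ch → Minimal ch)

  Infinite : Set
  Infinite = ¬ Finite

module _ {F : Signature} where

  -- rule l → r overlaps t at the non-variable position q (l renamed apart)
  Overlaps : Rule F → Term F → Pos → Set
  Overlaps ρ t q = NonVarPos t q × ∃ λ u → (t ∣ q ≡ just u) ×
    ∃ λ (σ₁ : Subst F) → ∃ λ (σ₂ : Subst F) → lhs ρ · σ₁ ≡ u · σ₂

  Πorth : (Rule F → Set) → (Pattern F → Set) → Pattern F → Set
  Πorth R Π π = Π π × (plabel π ≡ h ⊎ plabel π ≡ b) × Linear (pterm π)
    × (∀ ρ q → R ρ → (q ∥ ppos π ⊎ ppos π <ₚ q) → ¬ Overlaps ρ (pterm π) q)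

  nestTerm : CDP F → List (CDP F) → XTerm F
  nestTerm ρ [] = fill (cc ρ) (cp ρ) (erase (cr ρ))
  nestTerm ρ (ρ' ∷ rs) = fill (cc ρ) (cp ρ) (nestTerm ρ' rs)

  nestPos : CDP F → List (CDP F) → Pos
  nestPos ρ [] = cp ρ
  nestPos ρ (ρ' ∷ rs) = cp ρ ++ nestPos ρ' rs

  withCDP : CDP F → CDPProblem F → CDPProblem F
  withCDP ρ (problem P₀ R Π) = problem (λ x → x ≡ ρ ⊎ P₀ x) R Π

  SCPCond : ℕ → CDP F → CDPProblem F → Set
  SCPCond n ρ Prob = ∀ (rs : List (CDP F)) → length rs ≡ n ∸ 1 → All (PP Prob) rs →
    ForbiddenBy (Πorth (RR Prob) (ΠΠ Prob)) (nestTerm ρ rs) (nestPos ρ rs)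

  InSCP : ℕ → CDP F → CDPProblem F → CDPProblem F → Set₁
  InSCP n ρ Prob₀ Q =
      (SCPCond n ρ (withCDP ρ Prob₀) × Q ≡ Prob₀)
    ⊎ (¬ SCPCond n ρ (withCDP ρ Prob₀) × Q ≡ withCDP ρ Prob₀)

module Submission where

-- Completeness: the output problem has at most the CDPs of the input, so its
-- chains are chains of the input.  Soundness: let ρ be the CDP that SCP_n
-- removes.  If a chain of ({ρ} ⊎ P₀, R, Π) used ρ at index k, the side
-- condition (with L = n - 1) gives a Π_orth pattern ⟨t,p,λ⟩ (λ ∈ {h,b}, t
-- linear, no rule overlapping t parallel to or strictly below p) matching the
-- nested term c_k[… c_{k+L}[erase(t_{k+L})] …] at o above its nest position.
-- Along the chain from k to k+L+1 the terms keep all (possibly marked)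
-- symbols of t at p'_k.o: P-steps write the context symbols of the nested
-- term, and an R-step destroying one would be a redex overlapping t where
-- Π_orth excludes it.  By linearity erase(a_{k+L+1}) then contains an
-- instance of t at p'_k.o, so the pattern forbids the next P-step position
-- p'_{k+L+1}, contradicting the chain.  Thus every chain avoids ρ.

open import Defs
open import Data.Nat using (ℕ; zero; suc; _+_; _≤_; _<_; _∸_)
import Data.Nat as ℕ
open import Data.Nat.Properties
  using (+-suc; +-comm; +-identityʳ; +-cancelˡ-≡; m≤n⇒∃[o]m+o≡n; m≤n⇒m≤1+n; <⇒≤)
  renaming (≤-refl to ℕ-≤-refl)
open import Data.Vec using (Vec; []; _∷_)
open import Data.List using (List; []; _∷_; _++_; length)
open import Data.List.Properties using (++-assoc; ++-identityʳ; ++-cancelˡ; ++-conicalˡ; ++-conicalʳ)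
open import Data.List.Relation.Unary.All using (All; []; _∷_)
open import Data.Maybe using (Maybe; just; nothing; _<∣>_)
import Data.Maybe as Maybe
open import Data.Maybe.Properties using (just-injective)
open import Data.Product using (Σ; ∃; _×_; _,_; proj₁; proj₂)
open import Data.Sum using (_⊎_; inj₁; inj₂)
open import Data.Unit using (⊤; tt)
open import Data.Empty using (⊥; ⊥-elim)
open import Relation.Nullary using (¬_; Dec; yes; no)
open import Relation.Binary.PropositionalEquality

≤ₚ-refl : ∀ q → q ≤ₚ q
≤ₚ-refl q = [] , ++-identityʳ q

≤ₚ-++ : ∀ q r → q ≤ₚ (q ++ r)
≤ₚ-++ q r = r , refl

≤ₚ-trans : ∀ {x y z} → x ≤ₚ y → y ≤ₚ z → x ≤ₚ z
≤ₚ-trans {x} (r₁ , refl) (r₂ , refl) = r₁ ++ r₂ , sym (++-assoc x r₁ r₂)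

≤ₚ-prepend : ∀ x {y z} → y ≤ₚ z → (x ++ y) ≤ₚ (x ++ z)
≤ₚ-prepend x {y} (r , refl) = r , ++-assoc x y r

≤ₚ-cancel : ∀ x {y z} → (x ++ y) ≤ₚ (x ++ z) → y ≤ₚ z
≤ₚ-cancel x {y} {z} (r , e) = r , ++-cancelˡ x (y ++ r) z (trans (sym (++-assoc x y r)) e)

<ₚ⇒≤ₚ : ∀ {x y} → x <ₚ y → x ≤ₚ y
<ₚ⇒≤ₚ (r , _ , e) = r , e

<ₚ-prepend : ∀ x {y z} → y <ₚ z → (x ++ y) <ₚ (x ++ z)
<ₚ-prepend x {y} (r , r≢ε , refl) = r , r≢ε , ++-assoc x y r

<ₚ-cancel : ∀ x {y z} → (x ++ y) <ₚ (x ++ z) → y <ₚ z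
<ₚ-cancel x {y} {z} (r , r≢ε , e) = r , r≢ε , ++-cancelˡ x (y ++ r) z (trans (sym (++-assoc x y r)) e)

<ₚ⇒≱ₚ : ∀ {x y} → x <ₚ y → ¬ (y ≤ₚ x)
<ₚ⇒≱ₚ {x} (r , r≢ε , refl) (s , e) = r≢ε (++-conicalˡ r s (++-cancelˡ x (r ++ s) []
  (trans (sym (++-assoc x r s)) (trans e (sym (++-identityʳ x))))))

≤∧≱⇒<ₚ : ∀ {x y} → x ≤ₚ y → ¬ (y ≤ₚ x) → x <ₚ y
≤∧≱⇒<ₚ {x} ([] , e) y≰x = ⊥-elim (y≰x (subst (_≤ₚ x) (trans (sym (++-identityʳ x)) e) (≤ₚ-refl x)))
≤∧≱⇒<ₚ (i ∷ r , e) _ = i ∷ r , (λ ()) , e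

ε<ₚ∷ : ∀ i r → [] <ₚ (i ∷ r)
ε<ₚ∷ i r = i ∷ r , (λ ()) , refl

≮ₚε : ∀ x → ¬ (x <ₚ [])
≮ₚε x (r , r≢ε , e) = r≢ε (++-conicalʳ x r e)

∷-≤ₚ : ∀ {i j : ℕ} {x y} → (i ∷ x) ≤ₚ (j ∷ y) → i ≡ j × x ≤ₚ y
∷-≤ₚ (r , refl) = refl , (r , refl)

≤ₚ-comparable : ∀ {x y z} → x ≤ₚ z → y ≤ₚ z → x ≤ₚ y ⊎ y ≤ₚ x
≤ₚ-comparable {[]} _ _ = inj₁ (_ , refl)
≤ₚ-comparable {_ ∷ _} {[]} _ _ = inj₂ (_ , refl)
≤ₚ-comparable {i ∷ x} {j ∷ y} (r₁ , refl) (r₂ , e₂) with ∷-≤ₚ {j} {i} {y} {x ++ r₁} (r₂ , e₂)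
... | refl , y≤ with ≤ₚ-comparable {x} {y} {x ++ r₁} (r₁ , refl) y≤
... | inj₁ (s , e) = inj₁ (s , cong (i ∷_) e)
... | inj₂ (s , e) = inj₂ (s , cong (i ∷_) e)

_≤ₚ?_ : ∀ x y → Dec (x ≤ₚ y)
[] ≤ₚ? y = yes (y , refl)
(i ∷ x) ≤ₚ? [] = no λ { (_ , ()) }
(i ∷ x) ≤ₚ? (j ∷ y) with i ℕ.≟ j | x ≤ₚ? y
... | yes refl | yes (s , e) = yes (s , cong (i ∷_) e)
... | yes refl | no x≰y = no λ le → x≰y (proj₂ (∷-≤ₚ le))
... | no i≢j | _ = no λ le → i≢j (proj₁ (∷-≤ₚ le))

below-or-inside : ∀ {y} z w → y ≤ₚ (z ++ w) → ¬ (z ≤ₚ y) → y ≤ₚ z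
below-or-inside z w y≤ z≰y with ≤ₚ-comparable y≤ (≤ₚ-++ z w)
... | inj₁ y≤z = y≤z
... | inj₂ z≤y = ⊥-elim (z≰y z≤y)

nothing≢just : ∀ {A B : Set} {x : A} → nothing ≡ just x → B
nothing≢just ()

module _ {G : Signature} where

  head : Maybe (Term G) → Maybe (Sym G)
  head (just (fun f ts)) = just f
  head _ = nothing

  -- argument indices start at 1
  argAt-zero : ∀ {n} (ts : Vec (Term G) n) q → argAt ts zero q ≡ nothing
  argAt-zero [] q = refl
  argAt-zero (t ∷ ts) q = refl

  mutual
    ∣-++ : ∀ (s : Term G) q r {u} → s ∣ q ≡ just u → s ∣ (q ++ r) ≡ u ∣ r
    ∣-++ s [] r refl = refl
    ∣-++ (var x) (i ∷ q) r ()
    ∣-++ (fun f ts) (i ∷ q) r e = argAt-++ ts i q r e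

    argAt-++ : ∀ {n} (ts : Vec (Term G) n) i q r {u} → argAt ts i q ≡ just u → argAt ts i (q ++ r) ≡ u ∣ r
    argAt-++ [] i q r ()
    argAt-++ (t ∷ ts) zero q r ()
    argAt-++ (t ∷ ts) (suc zero) q r e = ∣-++ t q r e
    argAt-++ (t ∷ ts) (suc (suc i)) q r e = argAt-++ ts (suc i) q r e

  mutual
    ∣-prefix : ∀ (s : Term G) q r {w} → s ∣ (q ++ r) ≡ just w → Σ (Term G) λ u → (s ∣ q ≡ just u) × (u ∣ r ≡ just w)
    ∣-prefix s [] r e = s , refl , e
    ∣-prefix (var x) (i ∷ q) r ()
    ∣-prefix (fun f ts) (i ∷ q) r e = argAt-prefix ts i q r e

    argAt-prefix : ∀ {n} (ts : Vec (Term G) n) i q r {w} → argAt ts i (q ++ r) ≡ just w →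
                   Σ (Term G) λ u → (argAt ts i q ≡ just u) × (u ∣ r ≡ just w)
    argAt-prefix [] i q r ()
    argAt-prefix (t ∷ ts) zero q r ()
    argAt-prefix (t ∷ ts) (suc zero) q r e = ∣-prefix t q r e
    argAt-prefix (t ∷ ts) (suc (suc i)) q r e = argAt-prefix ts (suc i) q r e

  FunAt : Term G → Pos → Set
  FunAt s q = Σ (Sym G) λ g → Σ (Vec (Term G) (arity G g)) λ us → s ∣ q ≡ just (fun g us)

  <ₚ-FunAt : ∀ (s : Term G) q {q' w} → q <ₚ q' → s ∣ q' ≡ just w → FunAt s q
  <ₚ-FunAt s q ([] , ε≢ε , _) e = ⊥-elim (ε≢ε refl)
  <ₚ-FunAt s q (i ∷ r , _ , refl) e with ∣-prefix s q (i ∷ r) e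
  ... | var x , _ , ()
  ... | fun g us , e₁ , _ = g , us , e₁

  ≤ₚ-FunAt : ∀ (s : Term G) q r {f ts} → s ∣ (q ++ r) ≡ just (fun f ts) → FunAt s q
  ≤ₚ-FunAt s q [] {f} {ts} e = f , ts , trans (cong (s ∣_) (sym (++-identityʳ q))) e
  ≤ₚ-FunAt s q (i ∷ r) e = <ₚ-FunAt s q (i ∷ r , (λ ()) , refl) e

  mutual
    replace-∣ : ∀ (s : Term G) q r v {w} → s ∣ q ≡ just w → replace s q v ∣ (q ++ r) ≡ v ∣ r
    replace-∣ s [] r v e = refl
    replace-∣ (var x) (i ∷ q) r v ()
    replace-∣ (fun f ts) (i ∷ q) r v e = replaceArg-∣ ts i q r v e

    replaceArg-∣ : ∀ {n} (ts : Vec (Term G) n) i q r v {w} → argAt ts i q ≡ just w →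
                   argAt (replaceArg ts i q v) i (q ++ r) ≡ v ∣ r
    replaceArg-∣ [] i q r v ()
    replaceArg-∣ (t ∷ ts) zero q r v ()
    replaceArg-∣ (t ∷ ts) (suc zero) q r v e = replace-∣ t q r v e
    replaceArg-∣ (t ∷ ts) (suc (suc i)) q r v e = replaceArg-∣ ts (suc i) q r v e

  replace-∣-here : ∀ (s : Term G) q v {w} → s ∣ q ≡ just w → replace s q v ∣ q ≡ just v
  replace-∣-here s q v e = trans (cong (replace s q v ∣_) (sym (++-identityʳ q))) (replace-∣ s q [] v e)

  mutual
    replace-head : ∀ (s : Term G) q r v → ¬ (q ≤ₚ r) → head (replace s q v ∣ r) ≡ head (s ∣ r)
    replace-head s [] r v q≰r = ⊥-elim (q≰r (r , refl))
    replace-head (var x) (i ∷ q) r v q≰r = refl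
    replace-head (fun f ts) (i ∷ q) [] v q≰r = refl
    replace-head (fun f ts) (i ∷ q) (j ∷ r) v q≰r =
      replaceArg-head ts i q j r v (λ { refl q≤r → q≰r (≤ₚ-prepend (i ∷ []) q≤r) })

    replaceArg-head : ∀ {n} (ts : Vec (Term G) n) i q j r v → (i ≡ j → ¬ (q ≤ₚ r)) →
                      head (argAt (replaceArg ts i q v) j r) ≡ head (argAt ts j r)
    replaceArg-head [] i q j r v q≰r = refl
    replaceArg-head (t ∷ ts) zero q j r v q≰r = refl
    replaceArg-head (t ∷ ts) (suc zero) q zero r v q≰r = refl
    replaceArg-head (t ∷ ts) (suc zero) q (suc zero) r v q≰r = replace-head t q r v (q≰r refl)
    replaceArg-head (t ∷ ts) (suc zero) q (suc (suc j)) r v q≰r = refl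
    replaceArg-head (t ∷ ts) (suc (suc i)) q zero r v q≰r = refl
    replaceArg-head (t ∷ ts) (suc (suc i)) q (suc zero) r v q≰r = refl
    replaceArg-head (t ∷ ts) (suc (suc i)) q (suc (suc j)) r v q≰r =
      replaceArg-head ts (suc i) q (suc j) r v (λ e → q≰r (cong suc e))

  mutual
    ∣-· : ∀ (s : Term G) r (σ : Subst G) {u} → s ∣ r ≡ just u → (s · σ) ∣ r ≡ just (u · σ)
    ∣-· s [] σ refl = refl
    ∣-· (var x) (i ∷ r) σ ()
    ∣-· (fun f ts) (i ∷ r) σ e = argAt-· ts i r σ e

    argAt-· : ∀ {n} (ts : Vec (Term G) n) i r (σ : Subst G) {u} → argAt ts i r ≡ just u →
              argAt (mapSub ts σ) i r ≡ just (u · σ)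
    argAt-· [] i r σ ()
    argAt-· (t ∷ ts) zero r σ ()
    argAt-· (t ∷ ts) (suc zero) r σ e = ∣-· t r σ e
    argAt-· (t ∷ ts) (suc (suc i)) r σ e = argAt-· ts (suc i) r σ e

  head-· : ∀ (s : Term G) r σ {g} → head (s ∣ r) ≡ just g → head ((s · σ) ∣ r) ≡ just g
  head-· s r σ e with s ∣ r in eq
  head-· s r σ () | nothing
  head-· s r σ () | just (var x)
  ... | just (fun f ts) rewrite ∣-· s r σ eq = e

  head⇒fun : ∀ (m : Maybe (Term G)) {g} → head m ≡ just g → Σ (Vec (Term G) (arity G g)) λ us → m ≡ just (fun g us)
  head⇒fun (just (fun f ts)) refl = ts , refl
  head⇒fun nothing ()
  head⇒fun (just (var x)) ()

  Linear-∣ : ∀ {t : Term G} {q u} → Linear t → t ∣ q ≡ just u → Linear u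
  Linear-∣ {t} {q} lin e p p' x e₁ e₂ =
    ++-cancelˡ q p p' (lin (q ++ p) (q ++ p') x (trans (∣-++ t q p e) e₁) (trans (∣-++ t q p' e) e₂))

module _ {F : Signature} where

  TFreeAbove : XTerm F → Pos → Set
  TFreeAbove u X = ∀ r → r <ₚ X → ¬ (head (u ∣ r) ≡ just Tsym)

  mutual
    erase-∣ : ∀ (s : XTerm F) r {w} → TFreeAbove s r → s ∣ r ≡ just w → erase s ∣ r ≡ just (erase w)
    erase-∣ s [] _ refl = refl
    erase-∣ (var x) (i ∷ r) _ ()
    erase-∣ (fun (base f) ts) (i ∷ r) tf e = eraseV-argAt ts i r (λ r' lt → tf (i ∷ r') (<ₚ-prepend (i ∷ []) lt)) e
    erase-∣ (fun (mark f) ts) (i ∷ r) tf e = eraseV-argAt ts i r (λ r' lt → tf (i ∷ r') (<ₚ-prepend (i ∷ []) lt)) e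
    erase-∣ (fun Tsym (t ∷ [])) (i ∷ r) tf e = ⊥-elim (tf [] (ε<ₚ∷ i r) refl)
    erase-∣ (fun hole []) (i ∷ r) _ ()

    eraseV-argAt : ∀ {n} (ts : Vec (XTerm F) n) i r {w} → (∀ r' → r' <ₚ r → ¬ (head (argAt ts i r') ≡ just Tsym)) →
                   argAt ts i r ≡ just w → argAt (eraseV ts) i r ≡ just (erase w)
    eraseV-argAt [] i r _ ()
    eraseV-argAt (t ∷ ts) zero r _ ()
    eraseV-argAt (t ∷ ts) (suc zero) r tf e = erase-∣ t r tf e
    eraseV-argAt (t ∷ ts) (suc (suc i)) r tf e = eraseV-argAt ts (suc i) r tf e

  erase-subst : Subst (XSig F) → Subst (XSig F)
  erase-subst σ x = erase (σ x)

  mutual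
    erase-· : ∀ (s : XTerm F) σ → erase (s · σ) ≡ erase s · erase-subst σ
    erase-· (var x) σ = refl
    erase-· (fun (base f) ts) σ = cong (fun (base f)) (eraseV-· ts σ)
    erase-· (fun (mark f) ts) σ = cong (fun (base f)) (eraseV-· ts σ)
    erase-· (fun Tsym (t ∷ [])) σ = erase-· t σ
    erase-· (fun hole []) σ = refl

    eraseV-· : ∀ {n} (ts : Vec (XTerm F) n) σ → eraseV (mapSub ts σ) ≡ mapSub (eraseV ts) (erase-subst σ)
    eraseV-· [] σ = refl
    eraseV-· (t ∷ ts) σ = cong₂ _∷_ (erase-· t σ) (eraseV-· ts σ)

  mutual
    erase-emb-· : ∀ (u : Term F) σ → erase (emb u · σ) ≡ emb u · erase-subst σ
    erase-emb-· (var x) σ = refl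
    erase-emb-· (fun f ts) σ = cong (fun (base f)) (eraseV-embV-· ts σ)

    eraseV-embV-· : ∀ {n} (ts : Vec (Term F) n) σ → eraseV (mapSub (embV ts) σ) ≡ mapSub (embV ts) (erase-subst σ)
    eraseV-embV-· [] σ = refl
    eraseV-embV-· (t ∷ ts) σ = cong₂ _∷_ (erase-emb-· t σ) (eraseV-embV-· ts σ)

  mutual
    forget : XTerm F → Term F
    forget (var x) = var x
    forget (fun (base f) ts) = fun f (forgetV ts)
    forget (fun (mark f) ts) = fun f (forgetV ts)
    forget (fun Tsym ts) = var 0
    forget (fun hole ts) = var 0

    forgetV : ∀ {n} → Vec (XTerm F) n → Vec (Term F) n
    forgetV [] = []
    forgetV (t ∷ ts) = forget t ∷ forgetV ts

  forget-subst : Subst (XSig F) → Subst F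
  forget-subst σ x = forget (σ x)

  mutual
    forget-emb-· : ∀ (u : Term F) σ → forget (emb u · σ) ≡ u · forget-subst σ
    forget-emb-· (var x) σ = refl
    forget-emb-· (fun f ts) σ = cong (fun f) (forgetV-embV-· ts σ)

    forgetV-embV-· : ∀ {n} (ts : Vec (Term F) n) σ → forgetV (mapSub (embV ts) σ) ≡ mapSub ts (forget-subst σ)
    forgetV-embV-· [] σ = refl
    forgetV-embV-· (t ∷ ts) σ = cong₂ _∷_ (forget-emb-· t σ) (forgetV-embV-· ts σ)

  mutual
    emb-∣ : ∀ (t : Term F) q {u} → t ∣ q ≡ just u → emb t ∣ q ≡ just (emb u)
    emb-∣ t [] refl = refl
    emb-∣ (var x) (i ∷ q) ()
    emb-∣ (fun f ts) (i ∷ q) e = embV-argAt ts i q e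

    embV-argAt : ∀ {n} (ts : Vec (Term F) n) i q {u} → argAt ts i q ≡ just u → argAt (embV ts) i q ≡ just (emb u)
    embV-argAt [] i q ()
    embV-argAt (t ∷ ts) zero q ()
    embV-argAt (t ∷ ts) (suc zero) q e = emb-∣ t q e
    embV-argAt (t ∷ ts) (suc (suc i)) q e = embV-argAt ts (suc i) q e

  emb-·-head : ∀ (t : Term F) σ q {f ts} → t ∣ q ≡ just (fun f ts) → head ((emb t · σ) ∣ q) ≡ just (base f)
  emb-·-head t σ q e rewrite ∣-· (emb t) q σ (emb-∣ t q e) = refl

  HeadIs : Maybe (XTerm F) → Sym F → Set
  HeadIs m f = head m ≡ just (base f) ⊎ head m ≡ just (mark f)

  HeadIs-head : ∀ {m m' : Maybe (XTerm F)} {f} → head m ≡ head m' → HeadIs m' f → HeadIs m f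
  HeadIs-head e (inj₁ e′) = inj₁ (trans e e′)
  HeadIs-head e (inj₂ e′) = inj₂ (trans e e′)

  HeadIs-· : ∀ u r σ {f} → HeadIs (u ∣ r) f → HeadIs ((u · σ) ∣ r) f
  HeadIs-· u r σ (inj₁ e) = inj₁ (head-· u r σ e)
  HeadIs-· u r σ (inj₂ e) = inj₂ (head-· u r σ e)

  HeadIs⇒¬T : ∀ {m f} → HeadIs m f → ¬ (head m ≡ just Tsym)
  HeadIs⇒¬T (inj₁ e) e' with trans (sym e) e'
  ... | ()
  HeadIs⇒¬T (inj₂ e) e' with trans (sym e) e'
  ... | ()

  HeadIs-erase : ∀ (w : XTerm F) {f} → HeadIs (just w) f → head (just (erase w)) ≡ just (base f)
  HeadIs-erase (fun (base g) ts) (inj₁ refl) = refl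
  HeadIs-erase (fun (mark g) ts) (inj₂ refl) = refl
  HeadIs-erase (var x) (inj₁ ())
  HeadIs-erase (var x) (inj₂ ())
  HeadIs-erase (fun (base g) ts) (inj₂ ())
  HeadIs-erase (fun (mark g) ts) (inj₁ ())
  HeadIs-erase (fun Tsym ts) (inj₁ ())
  HeadIs-erase (fun Tsym ts) (inj₂ ())
  HeadIs-erase (fun hole ts) (inj₁ ())
  HeadIs-erase (fun hole ts) (inj₂ ())

  erase-HeadIs : ∀ (s : XTerm F) r {f} → TFreeAbove s r → HeadIs (s ∣ r) f → head (erase s ∣ r) ≡ just (base f)
  erase-HeadIs s r tf hs with s ∣ r in eq
  erase-HeadIs s r tf (inj₁ ()) | nothing
  erase-HeadIs s r tf (inj₂ ()) | nothing
  ... | just w rewrite erase-∣ s r tf eq = HeadIs-erase w hs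

  mutual
    NoT-erase-∣ : ∀ (c : XTerm F) r {w'} → NoT c → erase c ∣ r ≡ just w' →
                  Σ (XTerm F) λ w → (c ∣ r ≡ just w) × (erase w ≡ w')
    NoT-erase-∣ c [] nt refl = c , refl , refl
    NoT-erase-∣ (var x) (i ∷ r) nt ()
    NoT-erase-∣ (fun (base f) ts) (i ∷ r) nt e = NoT-eraseV-argAt ts i r (λ j q u e' → nt (j ∷ q) u e') e
    NoT-erase-∣ (fun (mark f) ts) (i ∷ r) nt e = NoT-eraseV-argAt ts i r (λ j q u e' → nt (j ∷ q) u e') e
    NoT-erase-∣ (fun Tsym (t ∷ [])) (i ∷ r) nt e = ⊥-elim (nt [] t refl)
    NoT-erase-∣ (fun hole []) (i ∷ r) nt ()

    NoT-eraseV-argAt : ∀ {n} (ts : Vec (XTerm F) n) i r {w'} →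
                       (∀ j q u → ¬ (argAt ts j q ≡ just (fun Tsym (u ∷ [])))) →
                       argAt (eraseV ts) i r ≡ just w' →
                       Σ (XTerm F) λ w → (argAt ts i r ≡ just w) × (erase w ≡ w')
    NoT-eraseV-argAt [] i r nt ()
    NoT-eraseV-argAt (t ∷ ts) zero r nt ()
    NoT-eraseV-argAt (t ∷ ts) (suc zero) r nt e = NoT-erase-∣ t r (λ q u e' → nt 1 q u e') e
    NoT-eraseV-argAt (t ∷ ts) (suc (suc i)) r nt e = NoT-eraseV-argAt ts (suc i) r nt' e
      where
        nt' : ∀ j q u → ¬ (argAt ts j q ≡ just (fun Tsym (u ∷ [])))
        nt' zero q u e' = nothing≢just (trans (sym (argAt-zero ts q)) e')
        nt' (suc j) q u e' = nt (suc (suc j)) q u e'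

  NoT-HeadIs : ∀ (c : XTerm F) r {f} → NoT c → head (erase c ∣ r) ≡ just (base f) → HeadIs (c ∣ r) f
  NoT-HeadIs c r {f} nt e with head⇒fun (erase c ∣ r) e
  ... | us , e₂ with NoT-erase-∣ c r nt e₂
  ... | w , e₃ , e₄ rewrite e₃ = at-root w e₄ (λ u e₅ → nt r u (trans e₃ (cong just e₅)))
    where
      at-root : ∀ (w : XTerm F) → erase w ≡ fun (base f) us → (∀ u → ¬ (w ≡ fun Tsym (u ∷ []))) → HeadIs (just w) f
      at-root (var x) () _
      at-root (fun (base g) ts) refl _ = inj₁ refl
      at-root (fun (mark g) ts) refl _ = inj₂ refl
      at-root (fun Tsym (u ∷ [])) _ notT = ⊥-elim (notT u refl)
      at-root (fun hole []) () _

-- Matching a linear F-term by its function symbols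

module _ {F : Signature} where

  mutual
    match-by-symbols : ∀ (t : Term F) (w : XTerm F) (σ : Subst (XSig F)) →
      (∀ q x u → t ∣ q ≡ just (var x) → w ∣ q ≡ just u → σ x ≡ u) →
      (∀ q f ts → t ∣ q ≡ just (fun f ts) → head (w ∣ q) ≡ just (base f)) →
      emb t · σ ≡ w
    match-by-symbols (var x) w σ hv hf = hv [] x w refl refl
    match-by-symbols (fun f ts) (var x) σ hv hf = nothing≢just (hf [] f ts refl)
    match-by-symbols (fun f ts) (fun g us) σ hv hf with hf [] f ts refl
    ... | refl = cong (fun (base f)) (matchV-by-symbols ts us σ (λ i q → hv (i ∷ q)) (λ i q → hf (i ∷ q)))

    matchV-by-symbols : ∀ {m} (ts : Vec (Term F) m) (us : Vec (XTerm F) m) σ →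
      (∀ i q x u → argAt ts i q ≡ just (var x) → argAt us i q ≡ just u → σ x ≡ u) →
      (∀ i q f ts' → argAt ts i q ≡ just (fun f ts') → head (argAt us i q) ≡ just (base f)) →
      mapSub (embV ts) σ ≡ us
    matchV-by-symbols [] [] σ hv hf = refl
    matchV-by-symbols (t ∷ ts) (u ∷ us) σ hv hf =
      cong₂ _∷_ (match-by-symbols t u σ (hv 1) (hf 1)) (matchV-by-symbols ts us σ hv' hf')
      where
        hv' : ∀ i q x u' → argAt ts i q ≡ just (var x) → argAt us i q ≡ just u' → σ x ≡ u'
        hv' zero q x u' e₁ e₂ = nothing≢just (trans (sym (argAt-zero ts q)) e₁)
        hv' (suc i) q x u' e₁ e₂ = hv (suc (suc i)) q x u' e₁ e₂
        hf' : ∀ i q f ts' → argAt ts i q ≡ just (fun f ts') → head (argAt us i q) ≡ just (base f)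
        hf' zero q f ts' e₁ = nothing≢just (trans (sym (argAt-zero ts q)) e₁)
        hf' (suc i) q f ts' e₁ = hf (suc (suc i)) q f ts' e₁

  shift : Pos → Pos
  shift [] = []
  shift (i ∷ q) = suc i ∷ q

  mutual
    occurrence : ℕ → Term F → Maybe Pos
    occurrence x (var y) with x ℕ.≟ y
    ... | yes _ = just []
    ... | no _ = nothing
    occurrence x (fun f ts) = occurrenceV x ts

    occurrenceV : ∀ {m} → ℕ → Vec (Term F) m → Maybe Pos
    occurrenceV x [] = nothing
    occurrenceV x (t ∷ ts) = Maybe.map (1 ∷_) (occurrence x t) <∣> Maybe.map shift (occurrenceV x ts)

  mutual
    occurrence-sound : ∀ x (t : Term F) {q} → occurrence x t ≡ just q → t ∣ q ≡ just (var x)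
    occurrence-sound x (var y) e with x ℕ.≟ y
    occurrence-sound x (var y) refl | yes refl = refl
    occurrence-sound x (var y) () | no _
    occurrence-sound x (fun f ts) e with occurrenceV-sound x ts e
    ... | i , q' , refl , e' = e'

    occurrenceV-sound : ∀ {m} x (ts : Vec (Term F) m) {q} → occurrenceV x ts ≡ just q →
                        Σ ℕ λ i → Σ Pos λ q' → (q ≡ i ∷ q') × (argAt ts i q' ≡ just (var x))
    occurrenceV-sound x [] ()
    occurrenceV-sound x (t ∷ ts) e with occurrence x t in e₁
    occurrenceV-sound x (t ∷ ts) refl | just q₀ = 1 , q₀ , refl , occurrence-sound x t e₁
    ... | nothing with occurrenceV x ts in e₂
    occurrenceV-sound x (t ∷ ts) () | nothing | nothing
    occurrenceV-sound x (t ∷ ts) refl | nothing | just q₁ with occurrenceV-sound x ts e₂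
    ... | zero , q' , refl , e₃ = nothing≢just (trans (sym (argAt-zero ts q')) e₃)
    ... | suc i , q' , refl , e₃ = suc (suc i) , q' , refl , e₃

  mutual
    occurrence-complete : ∀ x (t : Term F) q → t ∣ q ≡ just (var x) → Σ Pos λ q' → occurrence x t ≡ just q'
    occurrence-complete x (var y) [] refl with x ℕ.≟ x
    ... | yes _ = [] , refl
    ... | no x≢x = ⊥-elim (x≢x refl)
    occurrence-complete x (var y) (i ∷ q) ()
    occurrence-complete x (fun f ts) [] ()
    occurrence-complete x (fun f ts) (i ∷ q) e = occurrenceV-complete x ts i q e

    occurrenceV-complete : ∀ {m} x (ts : Vec (Term F) m) i q → argAt ts i q ≡ just (var x) →
                           Σ Pos λ q' → occurrenceV x ts ≡ just q'
    occurrenceV-complete x (t ∷ ts) i q e with occurrence x t in e₁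
    ... | just q₀ = 1 ∷ q₀ , refl
    ... | nothing with i
    ... | zero = nothing≢just e
    ... | suc zero with occurrence-complete x t q e
    ...   | q' , e' = nothing≢just (trans (sym e₁) e')
    occurrenceV-complete x (t ∷ ts) i q e | nothing | suc (suc i') with occurrenceV-complete x ts (suc i') q e
    ... | q₁ , e₂ rewrite e₂ = shift q₁ , refl

  -- a linear term matches every term carrying its function symbols: map each
  -- variable to the subterm at its (unique) occurrence
  linear-match : ∀ (t : Term F) (w : XTerm F) → Linear t →
    (∀ q f ts → t ∣ q ≡ just (fun f ts) → head (w ∣ q) ≡ just (base f)) →
    Σ (Subst (XSig F)) λ σ → w ≡ emb t · σ
  linear-match t w lin hf = σ , sym (match-by-symbols t w σ hv hf)
    where
      subtermOr : Maybe (XTerm F) → ℕ → XTerm F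
      subtermOr (just u) x = u
      subtermOr nothing x = var x

      σ : Subst (XSig F)
      σ x = Maybe.maybe (λ q → subtermOr (w ∣ q) x) (var x) (occurrence x t)

      hv : ∀ q x u → t ∣ q ≡ just (var x) → w ∣ q ≡ just u → σ x ≡ u
      hv q x u e₁ e₂ with occurrence-complete x t q e₁
      ... | q' , e₃ with lin q' q x (occurrence-sound x t e₃) e₁
      ... | refl rewrite e₃ | e₂ = refl

-- The path to the current CDP position stays T-free along a chain

module _ {F : Signature} where

  NoT-head : ∀ (c : XTerm F) r → NoT c → ¬ (head (c ∣ r) ≡ just Tsym)
  NoT-head c r nt isT with head⇒fun (c ∣ r) isT
  ... | u ∷ [] , e = nt r u e

  TFreeAbove-RStep : ∀ {R : Rule F → Set} {u q u' X} → RStep R u q u' → ¬ (q ≤ₚ X) →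
                     TFreeAbove u X → TFreeAbove u' X
  TFreeAbove-RStep {u = u} {q} (_ , _ , _ , _ , refl) q≰X tf r r<X isT =
    tf r r<X (trans (sym (replace-head u q r _ (λ q≤r → q≰X (≤ₚ-trans q≤r (<ₚ⇒≤ₚ r<X))))) isT)

  TFreeAbove-ChainSteps : ∀ {R : Rule F → Set} {Π X u v} → ChainSteps R Π X u v → TFreeAbove u X → TFreeAbove v X
  TFreeAbove-ChainSteps done tf = tf
  TFreeAbove-ChainSteps (step st q≰X _ rest) tf = TFreeAbove-ChainSteps rest (TFreeAbove-RStep st q≰X tf)

  TFreeAbove-PStep : ∀ (u : XTerm F) A {w} (c x : XTerm F) ph σ → u ∣ A ≡ just w → c ∣ ph ≡ just □ → NoT c →
                     TFreeAbove u A → TFreeAbove (replace u A (fill c ph x · σ)) (A ++ ph)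
  TFreeAbove-PStep u A c x ph σ eA eph nt tf r r<Aph with A ≤ₚ? r
  ... | no A≰r = λ isT →
        tf r (≤∧≱⇒<ₚ (below-or-inside A ph (<ₚ⇒≤ₚ r<Aph) A≰r) A≰r) (trans (sym (replace-head u A r _ A≰r)) isT)
  ... | yes (r' , refl) with <ₚ-FunAt c r' (<ₚ-cancel A r<Aph) eph
  ...   | g , us , ec = λ isT → NoT-head c r' nt (trans (cong head ec) (trans (sym step-head) (trans at-r' isT)))
    where
      step-head : head ((fill c ph x · σ) ∣ r') ≡ just g
      step-head = head-· (fill c ph x) r' σ
        (trans (replace-head c ph r' x (<ₚ⇒≱ₚ (<ₚ-cancel A r<Aph))) (cong head ec))
      at-r' : head ((fill c ph x · σ) ∣ r') ≡ head (replace u A (fill c ph x · σ) ∣ (A ++ r'))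
      at-r' = cong head (sym (replace-∣ u A r' _ eA))

-- Redexes carrying the symbols of a linear term unify with it

module _ {F : Signature} where

  redex-unifies : ∀ (u : XTerm F) q (s : Term F) → Linear s → (l : Term F) (σR : Subst (XSig F)) →
    u ∣ q ≡ just (emb l · σR) →
    (∀ q₂ g ts₂ → s ∣ q₂ ≡ just (fun g ts₂) → HeadIs (u ∣ (q ++ q₂)) g) →
    ∃ λ (σ₁ : Subst F) → ∃ λ (σ₂ : Subst F) → l · σ₁ ≡ s · σ₂
  redex-unifies u q s lin l σR eq carried =
      forget-subst (erase-subst σR) , forget-subst (proj₁ match) , unifier
    where
      v : XTerm F
      v = emb l · σR

      carried-v : ∀ q₂ g ts₂ → s ∣ q₂ ≡ just (fun g ts₂) → HeadIs (v ∣ q₂) g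
      carried-v q₂ g ts₂ e = subst (λ m → HeadIs m g) (∣-++ u q q₂ eq) (carried q₂ g ts₂ e)

      erased-symbols : ∀ q₂ g ts₂ → s ∣ q₂ ≡ just (fun g ts₂) → head (erase v ∣ q₂) ≡ just (base g)
      erased-symbols q₂ g ts₂ e = erase-HeadIs v q₂ path-T-free (carried-v q₂ g ts₂ e)
        where
          path-T-free : TFreeAbove v q₂
          path-T-free r r<q₂ with <ₚ-FunAt s r r<q₂ e
          ... | g' , us' , e' = HeadIs⇒¬T (carried-v r g' us' e')

      match : Σ (Subst (XSig F)) λ σ → erase v ≡ emb s · σ
      match = linear-match s (erase v) lin erased-symbols

      unifier : l · forget-subst (erase-subst σR) ≡ s · forget-subst (proj₁ match)
      unifier = begin
        l · forget-subst (erase-subst σR)   ≡⟨ sym (forget-emb-· l (erase-subst σR)) ⟩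
        forget (emb l · erase-subst σR)     ≡⟨ cong forget (sym (erase-emb-· l σR)) ⟩
        forget (erase v)                    ≡⟨ cong forget (proj₂ match) ⟩
        forget (emb s · proj₁ match)        ≡⟨ forget-emb-· s (proj₁ match) ⟩
        s · forget-subst (proj₁ match)      ∎
        where open ≡-Reasoning

-- Chain steps preserve the symbols of an occurrence of a Π_orth term

-- Fix a linear F-term t with a position p such that no rule of R overlaps t
-- at a position parallel to or strictly below p, and the position O of the
-- chain terms where the occurrence of t is being built.
module Occurrence {F : Signature} (R : Rule F → Set) (t : Term F) (p O : Pos) (lin : Linear t)
  (no-overlap : ∀ ρ q → R ρ → (q ∥ p ⊎ p <ₚ q) → ¬ Overlaps ρ t q) where

  Carries : (Pos → Set) → XTerm F → Set
  Carries Reg u = ∀ q₀ f ts → t ∣ q₀ ≡ just (fun f ts) → Reg (O ++ q₀) → HeadIs (u ∣ (O ++ q₀)) f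

  redex-position : ∀ E q q₀ → (O ++ p) ≤ₚ E → q ≤ₚ (O ++ q₀) → ¬ (q ≤ₚ E) →
                   Σ Pos λ q₁ → (q ≡ O ++ q₁) × (q₁ ∥ p ⊎ p <ₚ q₁) × (q₁ ≤ₚ q₀)
  redex-position E q q₀ Op≤E q≤ q≰E with ≤ₚ-comparable q≤ (≤ₚ-++ O q₀)
  ... | inj₁ q≤O = ⊥-elim (q≰E (≤ₚ-trans q≤O (≤ₚ-trans (≤ₚ-++ O p) Op≤E)))
  ... | inj₂ (q₁ , refl) = q₁ , refl , relation , ≤ₚ-cancel O q≤
    where
      relation : q₁ ∥ p ⊎ p <ₚ q₁
      relation with q₁ ≤ₚ? p | p ≤ₚ? q₁
      ... | yes q₁≤p | _ = ⊥-elim (q≰E (≤ₚ-trans (≤ₚ-prepend O q₁≤p) Op≤E))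
      ... | no q₁≰p | yes p≤q₁ = inj₂ (≤∧≱⇒<ₚ p≤q₁ q₁≰p)
      ... | no q₁≰p | no p≰q₁ = inj₁ (q₁≰p , p≰q₁)

  module RSteps (Reg : Pos → Set) (S E : Pos) (Op≤E : (O ++ p) ≤ₚ E)
    (below-in-region : ∀ q q₀ → Reg (O ++ q₀) → q ≤ₚ (O ++ q₀) → ¬ (q ≤ₚ S) → ∀ q₂ → Reg (q ++ q₂))
    (not-above-E : ∀ q q₀ → Reg (O ++ q₀) → q ≤ₚ (O ++ q₀) → ¬ (q ≤ₚ S) → ¬ (q ≤ₚ E)) where

    -- a redex above a carried symbol would overlap t where Π_orth forbids it
    Carries-RStep : ∀ {u q u'} → RStep R u q u' → ¬ (q ≤ₚ S) → Carries Reg u → Carries Reg u'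
    Carries-RStep {u} {q} (ρ , Rρ , σR , redex , refl) q≰S carries q₀ f ts e reg with q ≤ₚ? (O ++ q₀)
    ... | no q≰ = HeadIs-head (replace-head u q (O ++ q₀) _ q≰) (carries q₀ f ts e reg)
    ... | yes q≤ with redex-position E q q₀ Op≤E q≤ (not-above-E q q₀ reg q≤ q≰S)
    ... | q₁ , refl , rel , (r , refl) with ≤ₚ-FunAt t q₁ r e
    ... | f₁ , ts₁ , e₁ = ⊥-elim (no-overlap ρ q₁ Rρ rel ((f₁ , ts₁ , e₁) , fun f₁ ts₁ , e₁ ,
          redex-unifies u (O ++ q₁) (fun f₁ ts₁) (Linear-∣ {t = t} {q = q₁} lin e₁) (lhs ρ) σR redex carried))
      where
        carried : ∀ q₂ g ts₂ → fun f₁ ts₁ ∣ q₂ ≡ just (fun g ts₂) → HeadIs (u ∣ ((O ++ q₁) ++ q₂)) g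
        carried q₂ g ts₂ e₂ = subst (λ z → HeadIs (u ∣ z) g) (sym (++-assoc O q₁ q₂))
          (carries (q₁ ++ q₂) g ts₂ (trans (∣-++ t q₁ q₂ e₁) e₂)
            (subst Reg (++-assoc O q₁ q₂) (below-in-region (O ++ q₁) (q₁ ++ r) reg q≤ q≰S q₂)))

    Carries-ChainSteps : ∀ {Π u v} → ChainSteps R Π S u v → Carries Reg u → Carries Reg v
    Carries-ChainSteps done carries = carries
    Carries-ChainSteps (step st q≰S _ rest) carries = Carries-ChainSteps rest (Carries-RStep st q≰S carries)

  -- A P-step at A writes (c[x]_ph)σ.  The nested term Nt carries t at o and
  -- contains c[X]_ph at D, where A = Ab.D and O = Ab.o: the context symbols
  -- written by the step are the symbols of Nt.
  module PStep (u : XTerm F) (A : Pos) {w : XTerm F} (c x X : XTerm F) (ph : Pos) (σ : Subst (XSig F))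
    (Nt : XTerm F) (Ab D o : Pos)
    (eA : u ∣ A ≡ just w) (eph : c ∣ ph ≡ just □) (eAD : A ≡ Ab ++ D) (eO : O ≡ Ab ++ o)
    (eN : Nt ∣ D ≡ just (fill c ph X))
    (Nt-carries : ∀ q₀ f ts → t ∣ q₀ ≡ just (fun f ts) → head (Nt ∣ (o ++ q₀)) ≡ just (base f)) where

    written : XTerm F
    written = fill c ph x · σ

    u' : XTerm F
    u' = replace u A written

    relocate : ∀ q₀ r → A ++ r ≡ O ++ q₀ → o ++ q₀ ≡ D ++ r
    relocate q₀ r er = ++-cancelˡ Ab (o ++ q₀) (D ++ r)
      (trans (sym (++-assoc Ab o q₀)) (trans (cong (_++ q₀) (sym eO)) (trans (sym er)
        (trans (cong (_++ r) eAD) (++-assoc Ab D r)))))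

    Nt-symbol : ∀ q₀ r {f ts} → t ∣ q₀ ≡ just (fun f ts) → A ++ r ≡ O ++ q₀ → head (Nt ∣ (D ++ r)) ≡ just (base f)
    Nt-symbol q₀ r {f} e er = subst (λ z → head (Nt ∣ z) ≡ just (base f)) (relocate q₀ r er) (Nt-carries q₀ _ _ e)

    Carries-PStep : Carries (λ z → ¬ (A ≤ₚ z)) u → Carries (λ z → ¬ ((A ++ ph) ≤ₚ z)) u'
    Carries-PStep carries q₀ f ts e reg with A ≤ₚ? (O ++ q₀)
    ... | no A≰ = HeadIs-head (replace-head u A (O ++ q₀) _ A≰) (carries q₀ f ts e A≰)
    ... | yes (r , er) = inj₁ (trans (cong head (trans (cong (u' ∣_) (sym er)) (replace-∣ u A r written eA))) written-symbol)
      where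
        ph≰r : ¬ (ph ≤ₚ r)
        ph≰r ph≤r = reg (subst ((A ++ ph) ≤ₚ_) er (≤ₚ-prepend A ph≤r))
        context-symbol : head (c ∣ r) ≡ just (base f)
        context-symbol = trans (sym (replace-head c ph r X ph≰r))
          (trans (cong head (sym (∣-++ Nt D r eN))) (Nt-symbol q₀ r e er))
        written-symbol : head (written ∣ r) ≡ just (base f)
        written-symbol = head-· (fill c ph x) r σ (trans (replace-head c ph r x ph≰r) context-symbol)

    Carries-PStep-innermost : X ≡ erase x → NoT x → Carries (λ z → ¬ (A ≤ₚ z)) u → Carries (λ _ → ⊤) u'
    Carries-PStep-innermost eX nt carries q₀ f ts e _ with (A ++ ph) ≤ₚ? (O ++ q₀)
    ... | no Aph≰ = Carries-PStep carries q₀ f ts e Aph≰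
    ... | yes (r₂ , er) = subst (λ m → HeadIs m f) (sym at-x) (HeadIs-· x r₂ σ (NoT-HeadIs x r₂ nt erased-symbol))
      where
        er' : A ++ (ph ++ r₂) ≡ O ++ q₀
        er' = trans (sym (++-assoc A ph r₂)) er
        erased-symbol : head (erase x ∣ r₂) ≡ just (base f)
        erased-symbol = subst (λ z → head (z ∣ r₂) ≡ just (base f)) eX
          (trans (cong head (sym (replace-∣ c ph r₂ X eph)))
            (trans (cong head (sym (∣-++ Nt D (ph ++ r₂) eN))) (Nt-symbol q₀ (ph ++ r₂) e er')))
        at-x : u' ∣ (O ++ q₀) ≡ (x · σ) ∣ r₂
        at-x = trans (cong (u' ∣_) (sym er')) (trans (replace-∣ u A (ph ++ r₂) written eA)
                 (∣-++ written ph r₂ (∣-· (fill c ph x) ph σ (replace-∣-here c ph x eph))))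

module _ {F : Signature} where

  RootT? : (c : XTerm F) → RootT c ⊎ ¬ RootT c
  RootT? (var x) = inj₂ λ { (_ , ()) }
  RootT? (fun (base f) ts) = inj₂ λ { (_ , ()) }
  RootT? (fun (mark f) ts) = inj₂ λ { (_ , ()) }
  RootT? (fun Tsym (u ∷ [])) = inj₁ (u , refl)
  RootT? (fun hole ts) = inj₂ λ { (_ , ()) }

  NoT-if-not-rooted : ∀ (c : XTerm F) → TOnlyAtRoot c → ¬ RootT c → NoT c
  NoT-if-not-rooted c only-root not-rooted q u e with only-root q u e
  ... | refl = not-rooted (u , just-injective e)

module ChainFacts {F : Signature} (Prob : CDPProblem F) (wfP : ∀ ρ → PP Prob ρ → WFCDP ρ)
  (ρs : ℕ → CDP F) (ch : Chain Prob ρs) where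

  open Chain ch

  wf : ∀ j → WFCDP (ρs j)
  wf j = wfP (ρs j) (inP j)

  hole-at : ∀ j → cc (ρs j) ∣ cp (ρs j) ≡ just □
  hole-at j = proj₁ (wf j)

  A : ℕ → Pos
  A = accPos Prob ρs

  chain-T-free : ∀ j → TFreeAbove (as j) (A j)
  chain-T-free zero r r<ε = ⊥-elim (≮ₚε r r<ε)
  chain-T-free (suc j) = TFreeAbove-ChainSteps (Rsteps j)
    (TFreeAbove-PStep (as j) (A j) (cc (ρs j)) (cr (ρs j)) (cp (ρs j)) (σ j) (lhsAt j) (hole-at j)
      (proj₂ (proj₂ (proj₂ (proj₂ (proj₂ (proj₂ (wf j))))))) (chain-T-free j))

  following : ℕ → ℕ → List (CDP F)
  following j zero = []
  following j (suc l) = ρs (suc j) ∷ following (suc j) l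

  following-length : ∀ j l → length (following j l) ≡ l
  following-length j zero = refl
  following-length j (suc l) = cong suc (following-length (suc j) l)

  following-in-P : ∀ j l → All (PP Prob) (following j l)
  following-in-P j zero = []
  following-in-P j (suc l) = inP (suc j) ∷ following-in-P (suc j) l

  Nest : ℕ → ℕ → XTerm F
  Nest j l = nestTerm (ρs j) (following j l)

  holes : ℕ → ℕ → Pos
  holes j zero = []
  holes j (suc i) = cp (ρs j) ++ holes (suc j) i

  Nest-∣-holes : ∀ i l j → Nest j (i + l) ∣ holes j i ≡ just (Nest (i + j) l)
  Nest-∣-holes zero l j = refl
  Nest-∣-holes (suc i) l j = trans (replace-∣ (cc (ρs j)) (cp (ρs j)) (holes (suc j) i) _ (hole-at j))
    (trans (Nest-∣-holes i l (suc j)) (cong (λ z → just (Nest z l)) (+-suc i j)))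

  nestPos-holes : ∀ j l → nestPos (ρs j) (following j l) ≡ holes j (suc l)
  nestPos-holes j zero = sym (++-identityʳ _)
  nestPos-holes j (suc l) = cong (cp (ρs j) ++_) (nestPos-holes (suc j) l)

  holes-snoc : ∀ i j → holes j (suc i) ≡ holes j i ++ cp (ρs (i + j))
  holes-snoc zero j = ++-identityʳ _
  holes-snoc (suc i) j = trans (cong (cp (ρs j) ++_) (trans (holes-snoc i (suc j))
                           (cong (λ z → holes (suc j) i ++ cp (ρs z)) (+-suc i j))))
                           (sym (++-assoc (cp (ρs j)) (holes (suc j) i) _))

  A-holes : ∀ i k → A (i + k) ≡ A k ++ holes k i
  A-holes zero k = sym (++-identityʳ _)
  A-holes (suc i) k = trans (cong (_++ cp (ρs (i + k))) (A-holes i k))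
    (trans (++-assoc (A k) (holes k i) _) (cong (A k ++_) (sym (holes-snoc i k))))

  A-mono : ∀ {i i'} k → i ≤ i' → A (i + k) ≤ₚ A (i' + k)
  A-mono {i} k le with m≤n⇒∃[o]m+o≡n le
  ... | d , e = subst (λ z → A (i + k) ≤ₚ A (z + k)) (trans (+-comm d i) e) (extend d)
    where
      extend : ∀ d → A (i + k) ≤ₚ A ((d + i) + k)
      extend zero = ≤ₚ-refl _
      extend (suc d) = ≤ₚ-trans (extend d) (≤ₚ-++ _ _)

  Nest-context : ∀ k i l → Σ (XTerm F) λ X →
    (Nest k (i + l) ∣ holes k i ≡ just (fill (cc (ρs (i + k))) (cp (ρs (i + k))) X))
    × (l ≡ 0 → X ≡ erase (cr (ρs (i + k))))
  Nest-context k i zero = _ , Nest-∣-holes i zero k , λ _ → refl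
  Nest-context k i (suc l) = _ , Nest-∣-holes i (suc l) k , λ ()

  -- Suppose a linear term t with Π_orth's non-overlap property at p matches
  -- the nested term Nest k L at o, with o.p at or above its nest position.
  -- Then erase(a_{k+L+1}) contains an instance of t at p'_k.o.
  module OccurrenceAlongChain (k L : ℕ) (t : Term F) (p o : Pos) (σ₀ : Subst (XSig F)) (lin : Linear t)
    (no-overlap : ∀ ρ q → RR Prob ρ → (q ∥ p ⊎ p <ₚ q) → ¬ Overlaps ρ t q)
    (t-at-o : Nest k L ∣ o ≡ just (emb t · σ₀))
    (op≤holes : (o ++ p) ≤ₚ holes k (suc L)) where

    O : Pos
    O = A k ++ o

    open Occurrence (RR Prob) t p O lin no-overlap

    -- the position of the P-step following the last nested CDP
    E : Pos
    E = A (suc L + k)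

    E≡ : E ≡ A k ++ holes k (suc L)
    E≡ = A-holes (suc L) k

    Op≤E : (O ++ p) ≤ₚ E
    Op≤E = subst ((O ++ p) ≤ₚ_) (sym E≡)
             (subst (_≤ₚ (A k ++ holes k (suc L))) (sym (++-assoc (A k) o p)) (≤ₚ-prepend (A k) op≤holes))

    O≤E : O ≤ₚ E
    O≤E = ≤ₚ-trans (≤ₚ-++ O p) Op≤E

    Nest-carries : ∀ q₀ f ts → t ∣ q₀ ≡ just (fun f ts) → head (Nest k L ∣ (o ++ q₀)) ≡ just (base f)
    Nest-carries q₀ f ts e = trans (cong head (∣-++ (Nest k L) o q₀ t-at-o)) (emb-·-head t σ₀ q₀ e)

    nested-context : ∀ i → i ≤ L → Σ (XTerm F) λ X →
      (Nest k L ∣ holes k i ≡ just (fill (cc (ρs (i + k))) (cp (ρs (i + k))) X))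
      × (i ≡ L → X ≡ erase (cr (ρs (i + k))))
    nested-context i le with m≤n⇒∃[o]m+o≡n le
    ... | l , e with Nest-context k i l
    ... | X , at , innermost = X , subst (λ z → Nest k z ∣ holes k i ≡ just _) e at ,
          λ i≡L → innermost (+-cancelˡ-≡ i l 0 (trans (trans e (sym i≡L)) (sym (+-identityʳ i))))

    module PStepAt (i : ℕ) (le : i ≤ L) = PStep (as (i + k)) (A (i + k)) (cc (ρs (i + k))) (cr (ρs (i + k)))
        (proj₁ (nested-context i le)) (cp (ρs (i + k))) (σ (i + k)) (Nest k L) (A k) (holes k i) o
        (lhsAt (i + k)) (hole-at (i + k)) (A-holes i k) refl (proj₁ (proj₂ (nested-context i le))) Nest-carries

    carried-before : ∀ i → i ≤ L → Carries (λ z → ¬ (A (i + k) ≤ₚ z)) (as (i + k))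
    carried-before zero le q₀ f ts e outside = ⊥-elim (outside (≤ₚ-trans (≤ₚ-++ (A k) o) (≤ₚ-++ O q₀)))
    carried-before (suc i) le =
        Steps.Carries-ChainSteps (Rsteps (i + k)) (PStepAt.Carries-PStep i (<⇒≤ le) (carried-before i (<⇒≤ le)))
      where
        S : Pos
        S = A (suc i + k)
        S≤E : S ≤ₚ E
        S≤E = A-mono k (m≤n⇒m≤1+n le)
        below-in-region : ∀ q q₀ → ¬ (S ≤ₚ (O ++ q₀)) → q ≤ₚ (O ++ q₀) → ¬ (q ≤ₚ S) → ∀ q₂ → ¬ (S ≤ₚ (q ++ q₂))
        below-in-region q q₀ S≰ q≤ q≰S q₂ S≤ with ≤ₚ-comparable S≤ (≤ₚ-++ q q₂)
        ... | inj₁ S≤q = S≰ (≤ₚ-trans S≤q q≤)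
        ... | inj₂ q≤S = q≰S q≤S
        not-above-E : ∀ q q₀ → ¬ (S ≤ₚ (O ++ q₀)) → q ≤ₚ (O ++ q₀) → ¬ (q ≤ₚ S) → ¬ (q ≤ₚ E)
        not-above-E q q₀ S≰ q≤ q≰S q≤E with ≤ₚ-comparable q≤E S≤E
        ... | inj₁ q≤S = q≰S q≤S
        ... | inj₂ S≤q = S≰ (≤ₚ-trans S≤q q≤)
        module Steps = RSteps (λ z → ¬ (S ≤ₚ z)) S E Op≤E below-in-region not-above-E

    final : XTerm F
    final = as (suc L + k)

    erased-symbol : ∀ (Reg : Pos → Set) → Carries Reg final → ∀ q₀ f ts → t ∣ q₀ ≡ just (fun f ts) →
                    (∀ q₁ → q₁ ≤ₚ q₀ → Reg (O ++ q₁)) → head (erase final ∣ (O ++ q₀)) ≡ just (base f)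
    erased-symbol Reg carries q₀ f ts e in-region =
        erase-HeadIs final (O ++ q₀) path-T-free (carries q₀ f ts e (in-region q₀ (≤ₚ-refl q₀)))
      where
        path-T-free : TFreeAbove final (O ++ q₀)
        path-T-free r r< with O ≤ₚ? r
        ... | yes (q₁ , refl) with <ₚ-FunAt t q₁ (<ₚ-cancel O r<) e
        ...   | g , us , e₁ = HeadIs⇒¬T (carries q₁ g us e₁ (in-region q₁ (<ₚ⇒≤ₚ (<ₚ-cancel O r<))))
        path-T-free r r< | no O≰r = chain-T-free (suc L + k) r
          (≤∧≱⇒<ₚ (≤ₚ-trans (below-or-inside O q₀ (<ₚ⇒≤ₚ r<) O≰r) O≤E) (λ E≤r → O≰r (≤ₚ-trans O≤E E≤r)))

    innermost : XTerm F
    innermost = cr (ρs (L + k))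

    innermost-only-root : TOnlyAtRoot innermost
    innermost-only-root = proj₁ (proj₂ (proj₂ (proj₂ (proj₂ (proj₂ (wf (L + k)))))))

    innermost-erased : proj₁ (nested-context L ℕ-≤-refl) ≡ erase innermost
    innermost-erased = proj₂ (proj₂ (nested-context L ℕ-≤-refl)) refl

    -- if t_{L+k} is T-rooted, no R-steps follow and the part of the
    -- occurrence below E is an instance of erase(t_{L+k})
    symbol-below-E : RootT innermost → ∀ q₀ f ts r → t ∣ q₀ ≡ just (fun f ts) → E ++ r ≡ O ++ q₀ →
                     head (erase final ∣ (O ++ q₀)) ≡ just (base f)
    symbol-below-E T-rooted q₀ f ts r e er =
      trans (cong head (trans (cong (erase final ∣_) (sym er)) (∣-++ (erase final) E r final-at-E)))
        (subst (λ z → head (z ∣ r) ≡ just (base f)) (sym (erase-· innermost (σ (L + k))))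
          (head-· (erase innermost) r _ innermost-symbol))
      where
        c = cc (ρs (L + k))
        ph = cp (ρs (L + k))
        after-at-E : afterP Prob ρs σ as (L + k) ∣ E ≡ just (innermost · σ (L + k))
        after-at-E = trans (replace-∣ (as (L + k)) (A (L + k)) ph (fill c ph innermost · σ (L + k)) (lhsAt (L + k)))
                       (∣-· (fill c ph innermost) ph (σ (L + k)) (replace-∣-here c ph innermost (hole-at (L + k))))
        final-at-E : erase final ∣ E ≡ just (erase (innermost · σ (L + k)))
        final-at-E = erase-∣ final E (chain-T-free (suc L + k))
          (subst (λ z → z ∣ E ≡ just (innermost · σ (L + k))) (Tempty (L + k) T-rooted) after-at-E)
        relocated : o ++ q₀ ≡ holes k L ++ (ph ++ r)
        relocated = ++-cancelˡ (A k) (o ++ q₀) (holes k L ++ (ph ++ r))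
          (trans (sym (++-assoc (A k) o q₀)) (trans (sym er)
            (trans (++-assoc (A (L + k)) ph r)
              (trans (cong (_++ (ph ++ r)) (A-holes L k)) (++-assoc (A k) (holes k L) (ph ++ r))))))
        innermost-symbol : head (erase innermost ∣ r) ≡ just (base f)
        innermost-symbol = subst (λ z → head (z ∣ r) ≡ just (base f)) innermost-erased
          (trans (cong head (sym (replace-∣ c ph r _ (hole-at (L + k)))))
            (trans (cong head (sym (∣-++ (Nest k L) (holes k L) (ph ++ r) (proj₁ (proj₂ (nested-context L ℕ-≤-refl))))))
              (subst (λ z → head (Nest k L ∣ z) ≡ just (base f)) relocated (Nest-carries q₀ f ts e))))

    final-symbol : ∀ q₀ f ts → t ∣ q₀ ≡ just (fun f ts) → head (erase final ∣ (O ++ q₀)) ≡ just (base f)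
    final-symbol q₀ f ts e with RootT? innermost
    ... | inj₂ not-rooted = erased-symbol (λ _ → ⊤) carried-all q₀ f ts e (λ _ _ → tt)
      where
        carried-all : Carries (λ _ → ⊤) final
        carried-all = RSteps.Carries-ChainSteps (λ _ → ⊤) E E Op≤E (λ _ _ _ _ _ _ → tt) (λ _ _ _ _ q≰E → q≰E)
          (Rsteps (L + k))
          (PStepAt.Carries-PStep-innermost L ℕ-≤-refl innermost-erased
            (NoT-if-not-rooted innermost innermost-only-root not-rooted) (carried-before L ℕ-≤-refl))
    ... | inj₁ T-rooted with E ≤ₚ? (O ++ q₀)
    ...   | yes (r , er) = symbol-below-E T-rooted q₀ f ts r e er
    ...   | no E≰ = erased-symbol (λ z → ¬ (E ≤ₚ z)) carried-outside-E q₀ f ts e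
                       (λ q₁ q₁≤q₀ E≤ → E≰ (≤ₚ-trans E≤ (≤ₚ-prepend O q₁≤q₀)))
      where
        carried-outside-E : Carries (λ z → ¬ (E ≤ₚ z)) final
        carried-outside-E = subst (Carries (λ z → ¬ (E ≤ₚ z))) (Tempty (L + k) T-rooted)
                              (PStepAt.Carries-PStep L ℕ-≤-refl (carried-before L ℕ-≤-refl))

    instance-at-O : Σ (Subst (XSig F)) λ σ₁ → erase final ∣ O ≡ just (emb t · σ₁)
    instance-at-O with proj₁ (Pallowed (suc L + k)) | O≤E
    ... | u , at-E | r , Or≡E with ∣-prefix (erase final) O r (subst (λ z → erase final ∣ z ≡ just u) (sym Or≡E) at-E)
    ... | w , at-O , _ with linear-match t w lin (λ q₀ f ts e →
          trans (cong head (sym (∣-++ (erase final) O q₀ at-O))) (final-symbol q₀ f ts e))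
    ... | σ₁ , w≡ = σ₁ , trans at-O (cong just w≡)

  -- a nest position forbidden by Π_orth in the nested term starting at a
  -- chain index k would forbid the P-step of index k + L + 1
  nest-not-forbidden : ∀ k L → ¬ ForbiddenBy (Πorth (RR Prob) (ΠΠ Prob)) (Nest k L) (nestPos (ρs k) (following k L))
  nest-not-forbidden k L (_ , ⟨ t , p , _ ⟩ , (π∈Π , inj₁ refl , lin , no-ov) , (o , nest≡op , σ₀ , t-at-o)) =
      proj₂ (Pallowed (suc L + k))
        (proj₁ (Pallowed (suc L + k)) , ⟨ t , p , h ⟩ , π∈Π , (O , E≡Op , instance-at-O))
    where
      op≤holes : (o ++ p) ≤ₚ holes k (suc L)
      op≤holes = subst ((o ++ p) ≤ₚ_) (trans (sym nest≡op) (nestPos-holes k L)) (≤ₚ-refl _)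
      open OccurrenceAlongChain k L t p o σ₀ lin no-ov t-at-o op≤holes
      E≡Op : E ≡ O ++ p
      E≡Op = trans E≡ (trans (cong (A k ++_) (trans (sym (nestPos-holes k L)) nest≡op)) (sym (++-assoc (A k) o p)))
  nest-not-forbidden k L (_ , ⟨ t , p , _ ⟩ , (π∈Π , inj₂ refl , lin , no-ov) , (q , (o , refl , σ₀ , t-at-o) , q<nest)) =
      proj₂ (Pallowed (suc L + k))
        (proj₁ (Pallowed (suc L + k)) , ⟨ t , p , b ⟩ , π∈Π , (O ++ p , (O , refl , instance-at-O) , Op<E))
    where
      op≤holes : (o ++ p) ≤ₚ holes k (suc L)
      op≤holes = subst ((o ++ p) ≤ₚ_) (nestPos-holes k L) (<ₚ⇒≤ₚ q<nest)
      open OccurrenceAlongChain k L t p o σ₀ lin no-ov t-at-o op≤holes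
      Op<E : (O ++ p) <ₚ E
      Op<E = subst₂ _<ₚ_ (sym (++-assoc (A k) o p)) (trans (cong (A k ++_) (nestPos-holes k L)) (sym E≡))
               (<ₚ-prepend (A k) q<nest)

  avoids : ∀ n ρ → SCPCond n ρ Prob → ∀ j → ¬ (ρs j ≡ ρ)
  avoids n ρ cond j refl = nest-not-forbidden j (n ∸ 1)
    (cond (following j (n ∸ 1)) (following-length j (n ∸ 1)) (following-in-P j (n ∸ 1)))

-- a chain whose CDPs all lie in P' is also a chain of (P', R, Π);
-- minimality does not depend on the set of CDPs
relabel : ∀ {F} (Q : CDPProblem F) (P' : CDP F → Set) {ρs : ℕ → CDP F} →
          (∀ k → P' (ρs k)) → Chain Q ρs → Chain (problem P' (RR Q) (ΠΠ Q)) ρs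
relabel Q P' in-P' ch = record
  { inP = in-P' ; σ = σ ; as = as ; lhsAt = lhsAt ; Pallowed = Pallowed ; Rsteps = Rsteps ; Tempty = Tempty }
  where open Chain ch

theorem2 : (F : Signature) (n : ℕ) → 1 < n →
    (ρ : CDP F) (Prob₀ : CDPProblem F) → ¬ PP Prob₀ ρ →
    WFProblem (withCDP ρ Prob₀) →
      ((∀ Q → InSCP n ρ Prob₀ Q → Finite Q) → Finite (withCDP ρ Prob₀))
    × (Σ (CDPProblem F) (λ Q → InSCP n ρ Prob₀ Q × Infinite Q) → Infinite (withCDP ρ Prob₀))
theorem2 F n _ ρ Prob₀ _ (wf-CDPs , _ , _) = sound , complete
  where
    Prob = withCDP ρ Prob₀

    complete : Σ (CDPProblem F) (λ Q → InSCP n ρ Prob₀ Q × Infinite Q) → Infinite Prob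
    complete (Q , inj₂ (_ , refl) , infinite) = infinite
    complete (Q , inj₁ (_ , refl) , infinite) finite = infinite λ { (ρs , ch , minimal) →
      finite (ρs , relabel Prob₀ (PP Prob) (λ k → inj₂ (Chain.inP ch k)) ch , minimal) }

    -- an infinite minimal chain of Prob refutes the side condition (it would
    -- be a chain of Prob₀), so it is a chain of the output Prob
    sound : (∀ Q → InSCP n ρ Prob₀ Q → Finite Q) → Finite Prob
    sound finite-output (ρs , ch , minimal) = finite-output Prob (inj₂ (side-condition-fails , refl)) (ρs , ch , minimal)
      where
        side-condition-fails : ¬ SCPCond n ρ Prob
        side-condition-fails cond = finite-output Prob₀ (inj₁ (cond , refl)) (ρs , relabel Prob (PP Prob₀) in-P₀ ch , minimal)
          where
            in-P₀ : ∀ k → PP Prob₀ (ρs k)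
            in-P₀ k with Chain.inP ch k
            ... | inj₁ ρs-k≡ρ = ⊥-elim (ChainFacts.avoids Prob wf-CDPs ρs ch n ρ cond k ρs-k≡ρ)
            ... | inj₂ ρs-k∈P₀ = ρs-k∈P₀
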